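{- Let $\mathcal F$ be a finite pure simplicial complex that is partitionable, and let $q$ be a positive integer. Then $\mathcal F*[q]$ is a partitionable simplicial complex.
   Context: $[q]$ is the $0$-dimensional simplicial complex with $q$ vertices (disjoint from those of $\mathcal F$); the join is $\mathcal F*\mathcal K=\{\sigma\cup\tau:\sigma\in\mathcal F\cup\{\emptyset\},\tau\in\mathcal K\cup\{\emptyset\}\}$. A pure simplicial complex $\mathcal F$ is partitionable if there is an exact facing, i.e. a map $\varphi:\mathrm{facets}(\mathcal F)\to\mathcal F$ (faces including $\emptyset$) such that for every face $\sigma\in\mathcal F$ there is a unique facet $\tau$ with $\varphi(\tau)\subseteq\sigma\subseteq\tau$. -}

module Defs where

open import Data.Nat using (ℕ; _+_; _≤_)
open import Data.Fin.Subset using (Subset; _⊆_; ∣_∣; ⊥; Nonempty)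
open import Data.Vec using (_++_)
open import Data.Product using (Σ; ∃; _×_)
open import Relation.Binary.PropositionalEquality using (_≡_)

record IsComplex {n : ℕ} (F : Subset n → Set) : Set where
  field
    empty-face : F ⊥
    down-closed : ∀ {σ τ} → σ ⊆ τ → F τ → F σ

Facet : ∀ {n} → (Subset n → Set) → Subset n → Set
Facet F τ = F τ × (∀ σ → F σ → τ ⊆ σ → σ ≡ τ)

Pure : ∀ {n} → (Subset n → Set) → Set
Pure F = ∀ τ τ' → Facet F τ → Facet F τ' → ∣ τ ∣ ≡ ∣ τ' ∣

-- an exact facing: φ (only its values on facets matter) sends each facet to
-- a face (possibly ∅), and every face σ lies in exactly one interval
-- [φ τ , τ] with τ a facet.
IsExactFacing : ∀ {n} → (Subset n → Set) → (Subset n → Subset n) → Set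
IsExactFacing F φ =
  (∀ τ → Facet F τ → F (φ τ)) ×
  (∀ σ → F σ →
    Σ (Subset _) λ τ → (Facet F τ × φ τ ⊆ σ × σ ⊆ τ) ×
      (∀ τ' → Facet F τ' → φ τ' ⊆ σ → σ ⊆ τ' → τ' ≡ τ))

Partitionable : ∀ {n} → (Subset n → Set) → Set
Partitionable F = Pure F × ∃ λ φ → IsExactFacing F φ

-- [q]: the 0-dimensional complex on q vertices (∅ and the singletons)
Points : (q : ℕ) → Subset q → Set
Points q t = ∣ t ∣ ≤ 1

-- join of complexes on disjoint vertex sets Fin n and Fin q, realised on
-- Fin (n + q) (first n coordinates = vertices of F, last q = vertices of K).
-- Since both complexes contain ∅, this is {σ ∪ τ : σ ∈ F ∪ {∅}, τ ∈ K ∪ {∅}}.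
Join : ∀ {n q} → (Subset n → Set) → (Subset q → Set) → Subset (n + q) → Set
Join {n} {q} F K ρ = Σ (Subset n) λ s → Σ (Subset q) λ t → (ρ ≡ s ++ t) × F s × K t

{-# OPTIONS --safe #-}
-- An exact facing of a join is the product of exact facings: the interval
-- [φ s ∪ ψ t , s ∪ t] of a join facet s ∪ t is the product of the intervals
-- [φ s , s] and [ψ t , t], and the facets of the join are exactly the
-- products of facets.  So joins of partitionable complexes are partitionable, and it
-- remains to partition [q] for q ≥ 1: the facet {0} gets the interval [∅, {0}]
-- and every other facet {j} the one-element interval [{j}, {j}].
module Submission where

open import Defs
open import Data.Nat using (ℕ; suc; _+_; _≤_; z≤n; s≤s)
open import Data.Nat.Properties using (≤-trans; ≤-reflexive; 1+n≰n)
open import Data.Fin using (Fin; zero; suc)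
open import Data.Fin.Subset
  using (Subset; Nonempty; _⊆_; _∈_; ∣_∣; ⊥; ⁅_⁆; _-_; inside; outside)
open import Data.Fin.Subset.Properties
  using ( drop-∷-⊆; ⊆-refl; ⊆-reflexive; ⊥⊆; ∉⊥; p⊆q⇒∣p∣≤∣q∣; ∣⊥∣≡0; ∣⁅x⁆∣≡1; x∈⁅x⁆
        ; x∈⁅y⁆⇒x≡y; p─⊥≡p; ∣p─q∣≤∣p∣; p─q⊆p; x∈p∧x≢y⇒x∈p-y; nonempty?; Empty-unique)
open import Data.Vec using (Vec; []; _∷_; _++_; take; drop; here; there)
open import Data.Vec.Properties using (++-injective; ++-injectiveˡ; ++-injectiveʳ; take++drop≡id)
open import Data.Product using (Σ; ∃; _×_; _,_; proj₁; proj₂)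
open import Data.Sum using (_⊎_; inj₁; inj₂)
open import Relation.Nullary using (yes; no; contradiction)
open import Relation.Binary.PropositionalEquality
  using (_≡_; refl; sym; trans; cong; cong₂; subst; module ≡-Reasoning)

private
  variable
    n m q : ℕ
    A : Set

take-drop-++ : (s : Vec A n) (t : Vec A m) → take n (s ++ t) ≡ s × drop n (s ++ t) ≡ t
take-drop-++ {n = n} s t = ++-injective (take n (s ++ t)) s (take++drop≡id n (s ++ t))

⊥++⊥≡⊥ : ∀ n → ⊥ {n} ++ ⊥ {m} ≡ ⊥
⊥++⊥≡⊥ 0 = refl
⊥++⊥≡⊥ (suc n) = cong (outside ∷_) (⊥++⊥≡⊥ n)

∣p++q∣≡∣p∣+∣q∣ : (p : Subset n) (q : Subset m) → ∣ p ++ q ∣ ≡ ∣ p ∣ + ∣ q ∣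
∣p++q∣≡∣p∣+∣q∣ []            q = refl
∣p++q∣≡∣p∣+∣q∣ (inside  ∷ p) q = cong suc (∣p++q∣≡∣p∣+∣q∣ p q)
∣p++q∣≡∣p∣+∣q∣ (outside ∷ p) q = ∣p++q∣≡∣p∣+∣q∣ p q

++-⊆⁺ : {p p′ : Subset n} {q q′ : Subset m} → p ⊆ p′ → q ⊆ q′ → p ++ q ⊆ p′ ++ q′
++-⊆⁺ {p = []}    {[]}    _    q⊆q′ x∈      = q⊆q′ x∈
++-⊆⁺ {p = _ ∷ _} {_ ∷ _} p⊆p′ _    here with p⊆p′ here
... | here = here
++-⊆⁺ {p = _ ∷ _} {_ ∷ _} p⊆p′ q⊆q′ (there x∈) = there (++-⊆⁺ (drop-∷-⊆ p⊆p′) q⊆q′ x∈)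

++-⊆⁻ : (p p′ : Subset n) {q q′ : Subset m} → p ++ q ⊆ p′ ++ q′ → p ⊆ p′ × q ⊆ q′
++-⊆⁻ []      []        pq⊆ = (λ ()) , pq⊆
++-⊆⁻ (x ∷ p) (x′ ∷ p′) {q} {q′} pq⊆ = head⊆ , proj₂ tail⊆
  where
  tail⊆ : p ⊆ p′ × q ⊆ q′
  tail⊆ = ++-⊆⁻ p p′ (drop-∷-⊆ pq⊆)

  head⊆ : x ∷ p ⊆ x′ ∷ p′
  head⊆ here with pq⊆ here
  ... | here = here
  head⊆ (there y∈) = there (proj₁ tail⊆ y∈)

p⊆q∧∣q∣≤∣p∣⇒p≡q : {p q : Subset n} → p ⊆ q → ∣ q ∣ ≤ ∣ p ∣ → p ≡ q
p⊆q∧∣q∣≤∣p∣⇒p≡q {p = []}          {[]}          _   _          = refl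
p⊆q∧∣q∣≤∣p∣⇒p≡q {p = inside  ∷ p} {inside  ∷ q} p⊆q (s≤s ∣q∣≤∣p∣) =
  cong (inside ∷_) (p⊆q∧∣q∣≤∣p∣⇒p≡q (drop-∷-⊆ p⊆q) ∣q∣≤∣p∣)
p⊆q∧∣q∣≤∣p∣⇒p≡q {p = outside ∷ p} {outside ∷ q} p⊆q ∣q∣≤∣p∣ =
  cong (outside ∷_) (p⊆q∧∣q∣≤∣p∣⇒p≡q (drop-∷-⊆ p⊆q) ∣q∣≤∣p∣)
p⊆q∧∣q∣≤∣p∣⇒p≡q {p = outside ∷ p} {inside  ∷ q} p⊆q ∣q∣<∣p∣ =
  contradiction (≤-trans ∣q∣<∣p∣ (p⊆q⇒∣p∣≤∣q∣ (drop-∷-⊆ p⊆q))) 1+n≰n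
p⊆q∧∣q∣≤∣p∣⇒p≡q {p = inside  ∷ p} {outside ∷ q} p⊆q _ with p⊆q here
... | ()

x∈p⇒⁅x⁆⊆p : {x : Fin n} {p : Subset n} → x ∈ p → ⁅ x ⁆ ⊆ p
x∈p⇒⁅x⁆⊆p {x = x} {p} x∈p y∈⁅x⁆ = subst (_∈ p) (sym (x∈⁅y⁆⇒x≡y x y∈⁅x⁆)) x∈p

∣p∣≤1⇒p≡⊥⊎p≡⁅x⁆ : (p : Subset n) → ∣ p ∣ ≤ 1 → p ≡ ⊥ ⊎ ∃ λ x → p ≡ ⁅ x ⁆
∣p∣≤1⇒p≡⊥⊎p≡⁅x⁆ p ∣p∣≤1 with nonempty? p
... | no  p-empty  = inj₁ (Empty-unique p-empty)
... | yes (x , x∈p) =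
  inj₂ (x , sym (p⊆q∧∣q∣≤∣p∣⇒p≡q (x∈p⇒⁅x⁆⊆p x∈p) (≤-trans ∣p∣≤1 (≤-reflexive (sym (∣⁅x⁆∣≡1 x))))))

joinFacing : (Subset n → Subset n) → (Subset m → Subset m) → Subset (n + m) → Subset (n + m)
joinFacing {n} φ ψ ρ = φ (take n ρ) ++ ψ (drop n ρ)

joinFacing-++ : (φ : Subset n → Subset n) (ψ : Subset m → Subset m) (s : Subset n) (t : Subset m) →
                joinFacing φ ψ (s ++ t) ≡ φ s ++ ψ t
joinFacing-++ φ ψ s t = let take≡ , drop≡ = take-drop-++ s t in cong₂ (λ a b → φ a ++ ψ b) take≡ drop≡

module _ {F : Subset n → Set} {K : Subset m → Set} where

  join-isComplex : IsComplex F → IsComplex K → IsComplex (Join F K)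
  join-isComplex cF cK = record
    { empty-face  = ⊥ , ⊥ , sym (⊥++⊥≡⊥ n) , empty-face cF , empty-face cK
    ; down-closed = down-closed′
    }
    where
    open IsComplex

    down-closed′ : ∀ {σ τ} → σ ⊆ τ → Join F K τ → Join F K σ
    down-closed′ {σ} σ⊆ (s , t , refl , Fs , Kt) =
      let σ≡ = sym (take++drop≡id n σ)
          s⊆ , t⊆ = ++-⊆⁻ (take n σ) s (subst (_⊆ s ++ t) σ≡ σ⊆)
      in take n σ , drop n σ , σ≡ , down-closed cF s⊆ Fs , down-closed cK t⊆ Kt

  join-facet⁺ : {s : Subset n} {t : Subset m} → Facet F s → Facet K t → Facet (Join F K) (s ++ t)
  join-facet⁺ {s} {t} (Fs , s-max) (Kt , t-max) = (s , t , refl , Fs , Kt) , st-max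
    where
    st-max : ∀ ρ → Join F K ρ → s ++ t ⊆ ρ → ρ ≡ s ++ t
    st-max _ (s′ , t′ , refl , Fs′ , Kt′) st⊆ =
      let s⊆ , t⊆ = ++-⊆⁻ s s′ st⊆
      in cong₂ _++_ (s-max s′ Fs′ s⊆) (t-max t′ Kt′ t⊆)

  join-facet⁻ : ∀ {ρ} → Facet (Join F K) ρ →
                Σ (Subset n) λ s → Σ (Subset m) λ t → ρ ≡ s ++ t × Facet F s × Facet K t
  join-facet⁻ ((s , t , refl , Fs , Kt) , ρ-max) = s , t , refl , (Fs , s-max) , (Kt , t-max)
    where
    s-max : ∀ σ → F σ → s ⊆ σ → σ ≡ s
    s-max σ Fσ s⊆σ = ++-injectiveˡ σ s (ρ-max (σ ++ t) (σ , t , refl , Fσ , Kt) (++-⊆⁺ s⊆σ ⊆-refl))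

    t-max : ∀ τ → K τ → t ⊆ τ → τ ≡ t
    t-max τ Kτ t⊆τ = ++-injectiveʳ s s (ρ-max (s ++ τ) (s , τ , refl , Fs , Kτ) (++-⊆⁺ ⊆-refl t⊆τ))

  join-pure : Pure F → Pure K → Pure (Join F K)
  join-pure pF pK ρ ρ′ fρ fρ′
    with s , t , refl , fs , ft ← join-facet⁻ fρ
       | s′ , t′ , refl , fs′ , ft′ ← join-facet⁻ fρ′ = begin
    ∣ s ++ t ∣        ≡⟨ ∣p++q∣≡∣p∣+∣q∣ s t ⟩
    ∣ s ∣ + ∣ t ∣     ≡⟨ cong₂ _+_ (pF s s′ fs fs′) (pK t t′ ft ft′) ⟩
    ∣ s′ ∣ + ∣ t′ ∣   ≡⟨ ∣p++q∣≡∣p∣+∣q∣ s′ t′ ⟨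
    ∣ s′ ++ t′ ∣      ∎
    where open ≡-Reasoning

  join-exactFacing : {φ : Subset n → Subset n} {ψ : Subset m → Subset m} →
                     IsExactFacing F φ → IsExactFacing K ψ → IsExactFacing (Join F K) (joinFacing φ ψ)
  join-exactFacing {φ} {ψ} (φ-face , φ-interval) (ψ-face , ψ-interval) = face , interval
    where
    face : ∀ ρ → Facet (Join F K) ρ → Join F K (joinFacing φ ψ ρ)
    face ρ fρ with s , t , refl , fs , ft ← join-facet⁻ fρ =
      subst (Join F K) (sym (joinFacing-++ φ ψ s t)) (φ s , ψ t , refl , φ-face s fs , ψ-face t ft)

    interval : ∀ σ → Join F K σ →
               Σ (Subset (n + m)) λ τ → (Facet (Join F K) τ × joinFacing φ ψ τ ⊆ σ × σ ⊆ τ) ×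
                 (∀ τ′ → Facet (Join F K) τ′ → joinFacing φ ψ τ′ ⊆ σ → σ ⊆ τ′ → τ′ ≡ τ)
    interval _ (s , t , refl , Fs , Kt)
      with τs , (fτs , φ⊆s , s⊆τs) , s-unique ← φ-interval s Fs
         | τt , (fτt , ψ⊆t , t⊆τt) , t-unique ← ψ-interval t Kt
      = τs ++ τt , (join-facet⁺ fτs fτt , φψ⊆ , ++-⊆⁺ s⊆τs t⊆τt) , unique
      where
      φψ⊆ : joinFacing φ ψ (τs ++ τt) ⊆ s ++ t
      φψ⊆ = subst (_⊆ s ++ t) (sym (joinFacing-++ φ ψ τs τt)) (++-⊆⁺ φ⊆s ψ⊆t)

      unique : ∀ τ′ → Facet (Join F K) τ′ → joinFacing φ ψ τ′ ⊆ s ++ t → s ++ t ⊆ τ′ → τ′ ≡ τs ++ τt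
      unique τ′ fτ′ φψ⊆′ st⊆ with s′ , t′ , refl , fs′ , ft′ ← join-facet⁻ fτ′ =
        let φ⊆ , ψ⊆ = ++-⊆⁻ (φ s′) s (subst (_⊆ s ++ t) (joinFacing-++ φ ψ s′ t′) φψ⊆′)
            s⊆ , t⊆ = ++-⊆⁻ s s′ st⊆
        in cong₂ _++_ (s-unique s′ fs′ φ⊆ s⊆) (t-unique t′ ft′ ψ⊆ t⊆)

  join-partitionable : Partitionable F → Partitionable K → Partitionable (Join F K)
  join-partitionable (pF , φ , eF) (pK , ψ , eK) = join-pure pF pK , joinFacing φ ψ , join-exactFacing eF eK

points-isComplex : IsComplex (Points q)
points-isComplex {q} = record
  { empty-face  = ≤-trans (≤-reflexive (∣⊥∣≡0 q)) z≤n
  ; down-closed = λ σ⊆τ ∣τ∣≤1 → ≤-trans (p⊆q⇒∣p∣≤∣q∣ σ⊆τ) ∣τ∣≤1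
  }

points-facet⁺ : (x : Fin q) → Facet (Points q) ⁅ x ⁆
points-facet⁺ x = ≤-reflexive (∣⁅x⁆∣≡1 x) , ⁅x⁆-max
  where
  ⁅x⁆-max : ∀ σ → ∣ σ ∣ ≤ 1 → ⁅ x ⁆ ⊆ σ → σ ≡ ⁅ x ⁆
  ⁅x⁆-max σ ∣σ∣≤1 x⊆σ = sym (p⊆q∧∣q∣≤∣p∣⇒p≡q x⊆σ (≤-trans ∣σ∣≤1 (≤-reflexive (sym (∣⁅x⁆∣≡1 x)))))

points-facet⁻ : {p : Subset (suc q)} → Facet (Points (suc q)) p → ∃ λ x → p ≡ ⁅ x ⁆
points-facet⁻ {q} {p} (∣p∣≤1 , p-max) with ∣p∣≤1⇒p≡⊥⊎p≡⁅x⁆ p ∣p∣≤1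
... | inj₂ p≡⁅x⁆ = p≡⁅x⁆
... | inj₁ refl with p-max ⁅ zero ⁆ (proj₁ (points-facet⁺ {suc q} zero)) ⊥⊆
...   | ()

points-pure : Pure (Points (suc q))
points-pure p p′ fp fp′ with x , refl ← points-facet⁻ fp | y , refl ← points-facet⁻ fp′ =
  trans (∣⁅x⁆∣≡1 x) (sym (∣⁅x⁆∣≡1 y))

⁅zero⁆-zero≡⊥ : ⁅ zero ⁆ - zero ≡ ⊥ {suc q}
⁅zero⁆-zero≡⊥ = cong (outside ∷_) (p─⊥≡p ⊥)

points-exactFacing : IsExactFacing (Points (suc q)) (_- zero)
points-exactFacing {q} = face , interval
  where
  face : ∀ p → Facet (Points (suc q)) p → Points (suc q) (p - zero)
  face p (∣p∣≤1 , _) = ≤-trans (∣p─q∣≤∣p∣ p ⁅ zero ⁆) ∣p∣≤1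

  interval : ∀ σ → Points (suc q) σ →
             Σ (Subset (suc q)) λ τ → (Facet (Points (suc q)) τ × τ - zero ⊆ σ × σ ⊆ τ) ×
               (∀ τ′ → Facet (Points (suc q)) τ′ → τ′ - zero ⊆ σ → σ ⊆ τ′ → τ′ ≡ τ)
  interval σ ∣σ∣≤1 with ∣p∣≤1⇒p≡⊥⊎p≡⁅x⁆ σ ∣σ∣≤1
  ... | inj₁ refl = ⁅ zero ⁆ , (points-facet⁺ zero , ⊆-reflexive ⁅zero⁆-zero≡⊥ , ⊥⊆) , unique
    where
    unique : ∀ τ′ → Facet (Points (suc q)) τ′ → τ′ - zero ⊆ ⊥ → ⊥ ⊆ τ′ → τ′ ≡ ⁅ zero ⁆
    unique τ′ fτ′ τ′-zero⊆⊥ _ with points-facet⁻ fτ′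
    ... | zero  , refl = refl
    ... | suc x , refl = contradiction (τ′-zero⊆⊥ (x∈p∧x≢y⇒x∈p-y {y = zero} (x∈⁅x⁆ (suc x)) λ ())) ∉⊥
  ... | inj₂ (x , refl) = ⁅ x ⁆ , (points-facet⁺ x , p─q⊆p ⁅ x ⁆ ⁅ zero ⁆ , ⊆-refl) , unique
    where
    unique : ∀ τ′ → Facet (Points (suc q)) τ′ → τ′ - zero ⊆ ⁅ x ⁆ → ⁅ x ⁆ ⊆ τ′ → τ′ ≡ ⁅ x ⁆
    unique τ′ fτ′ _ x⊆τ′ = proj₂ (points-facet⁺ x) τ′ (proj₁ fτ′) x⊆τ′

points-partitionable : 1 ≤ q → Partitionable (Points q)
points-partitionable (s≤s z≤n) = points-pure , (_- zero) , points-exactFacing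

theorem4p6 : (n : ℕ) (F : Subset n → Set) → IsComplex F → Pure F → Partitionable F → Σ (Subset n) (λ v → F v × Nonempty v) → (q : ℕ) → 1 ≤ q → IsComplex (Join F (Points q)) × Partitionable (Join F (Points q))
-- Purity is part of partitionability, and F needs no nonempty face.
theorem4p6 _ _ cF _ partF _ _ 1≤q =
  join-isComplex cF points-isComplex , join-partitionable partF (points-partitionable 1≤q)
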